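{- An assembly $(X,E_X)$ over $\mathcal S$ is order-discrete (as an object of ${\sf RT}(\mathcal S)$) if and only if for all $x,y\in X$: if there exist $U\in E_X(x)$ and $V\in E_X(y)$ with $U\subseteq V$, then $x=y$.
   Context: $\mathcal S$ is Scott's graph model $\mathcal P(\mathbb N)$ with its standard application, and ${\sf RT}(\mathcal S)$ the realizability topos over it. An assembly is a pair $(X,E_X)$ with $E_X(x)$ a nonempty subset of $\mathcal S$ for each $x\in X$, viewed as an object of ${\sf RT}(\mathcal S)$. The Sierpinski object is the assembly $\Sigma=(\{0,1\},E_\Sigma)$ with $E_\Sigma(0)=\{\emptyset\}$, $E_\Sigma(1)=\{\{1\}\}$. An object $X$ is order-discrete if the diagonal $\delta_X\colon X\to X^\Sigma$ is an isomorphism. -}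

module Defs where

open import Data.Nat.Base using (ℕ; zero; suc; _+_; _*_; _%_; ⌊_/2⌋; _≡ᵇ_)
open import Data.Bool.Base using (Bool; true; false)
open import Data.Product using (Σ; _×_; _,_)
open import Data.Empty using (⊥)
open import Relation.Binary.PropositionalEquality using (_≡_)

-- Scott's graph model S = P(ℕ).  Subsets of ℕ are predicates ℕ → Set.

𝒮 : Set₁
𝒮 = ℕ → Set

_⊆_ : 𝒮 → 𝒮 → Set
U ⊆ V = ∀ n → U n → V n

_≐_ : 𝒮 → 𝒮 → Set
U ≐ V = (U ⊆ V) × (V ⊆ U)

bit : ℕ → ℕ → Bool
bit n zero    = (n % 2) ≡ᵇ 1
bit n (suc k) = bit ⌊ n /2⌋ k

-- e_n : the n-th finite set (k ∈ e_n iff the k-th bit of n is 1)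
e : ℕ → 𝒮
e n k = bit n k ≡ true

pair : ℕ → ℕ → ℕ
pair n m = ⌊ (n + m) * suc (n + m) /2⌋ + m

_·_ : 𝒮 → 𝒮 → 𝒮
(U · V) m = Σ ℕ λ n → (e n ⊆ V) × U (pair n m)

infixl 7 _·_

-- Assemblies over 𝒮.  Realizer sets are required to respect extensional
-- equality of subsets of ℕ (they are sets of elements of P(ℕ)).

record Assembly : Set₁ where
  field
    Carrier  : Set
    E        : Carrier → 𝒮 → Set
    nonempty : ∀ x → Σ 𝒮 λ U → E x U
    E-ext    : ∀ x U V → U ≐ V → E x U → E x V
open Assembly public

-- The Sierpinski object Σ: carrier {0,1} (false = 0, true = 1),
-- E(0) = {∅}, E(1) = {{1}}.
E-Sierpinski : Bool → 𝒮 → Set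
E-Sierpinski false U = ∀ n → U n → ⊥
E-Sierpinski true  U = (U 1) × (∀ n → U n → n ≡ 1)

Tracks : {A B : Set} (EA : A → 𝒮 → Set) (EB : B → 𝒮 → Set) → 𝒮 → (A → B) → Set₁
Tracks EA EB r f = ∀ a U → EA a U → EB (f a) (r · U)

-- Elements of the exponential X^Σ (in Asm, hence in RT(𝒮)): tracked maps
-- Bool → Carrier X; their realizers are their trackers.
TrackedΣ : (X : Assembly) → (Bool → Carrier X) → 𝒮 → Set₁
TrackedΣ X f r = Tracks E-Sierpinski (E X) r f

IsTrackedΣ : (X : Assembly) → (Bool → Carrier X) → Set₁
IsTrackedΣ X f = Σ 𝒮 λ r → TrackedΣ X f r

δ : (X : Assembly) → Carrier X → (Bool → Carrier X)
δ X x _ = x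

-- δ_X is an isomorphism (of assemblies, equivalently in RT(𝒮)):
--  * δ_X is tracked;
--  * there is a map g : X^Σ → X (defined on tracked maps, independent of the
--    tracking witness), tracked, with g ∘ δ = id and δ ∘ g = id.
IsOrderDiscrete : Assembly → Set₁
IsOrderDiscrete X =
  (Σ 𝒮 λ t → ∀ x U → E X x U → TrackedΣ X (δ X x) (t · U))
  × Σ ((f : Bool → Carrier X) → IsTrackedΣ X f → Carrier X) λ g →
      (∀ f p q → g f p ≡ g f q)
    × (Σ 𝒮 λ r → ∀ f p V → TrackedΣ X f V → E X (g f p) (r · V))
    × (∀ x p → g (δ X x) p ≡ x)
    × (∀ f p b → δ X (g f p) b ≡ f b)

module Submission where

-- The proof rests on three realizers
-- built from the Cantor pairing and the finite sets e_n:
--   * K      with  K · U · W ≐ U          (tracks the diagonal δ_X),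
--   * atEmpty with atEmpty · V ≐ V · ∅    (tracks evaluation at 0 : Σ),
--   * branch U V with branch U V · ∅ ≐ U and branch U V · {1} ≐ V when U ⊆ V.
-- These need injectivity of the pairing function and singleton codes e_⟨j⟩ = {j}.
-- (⇒) If U ⊆ V realize x and y, then branch U V tracks the map 0 ↦ x, 1 ↦ y;
--     since δ_X is onto, this map is constant, so x = y.
-- (⇐) Since ∅ ⊆ {1} and application is monotone, r · ∅ ⊆ r · {1} for every
--     tracker r, so every tracked map Σ → X is constant; its inverse to δ_X
--     is evaluation at 0, tracked by atEmpty, and δ_X is tracked by K.

open import Defs
open import Data.Nat.Base
open import Data.Nat.Properties
open import Data.Nat.DivMod using (m*n%n≡0)
open import Data.Nat.Tactic.RingSolver using (solve-∀)
open import Data.Bool.Base using (Bool; true; false)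
open import Data.Product using (Σ; _×_; _,_)
open import Data.Sum using (_⊎_; inj₁; inj₂)
open import Data.Empty using (⊥; ⊥-elim)
open import Relation.Binary.Definitions using (tri<; tri≈; tri>)
open import Relation.Binary.PropositionalEquality
open import Function.Bundles using (_⇔_; mk⇔)

⌊n*2/2⌋≡n : ∀ n → ⌊ n * 2 /2⌋ ≡ n
⌊n*2/2⌋≡n zero    = refl
⌊n*2/2⌋≡n (suc n) = cong suc (⌊n*2/2⌋≡n n)

-- Triangular numbers  tri s = s(s+1)/2, defined without division.
tri : ℕ → ℕ
tri zero    = zero
tri (suc s) = suc s + tri s

tri-double : ∀ s → s * suc s ≡ tri s * 2
tri-double zero    = refl
tri-double (suc s) = begin
    suc s * suc (suc s)    ≡⟨ expand s ⟩
    s * suc s + suc s * 2  ≡⟨ cong (_+ suc s * 2) (tri-double s) ⟩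
    tri s * 2 + suc s * 2  ≡⟨ sym (*-distribʳ-+ 2 (tri s) (suc s)) ⟩
    (tri s + suc s) * 2    ≡⟨ cong (_* 2) (+-comm (tri s) (suc s)) ⟩
    tri (suc s) * 2        ∎
  where
  open ≡-Reasoning
  expand : ∀ s → suc s * suc (suc s) ≡ s * suc s + suc s * 2
  expand = solve-∀

-- The pair (n,m) sits at offset m on the diagonal n + m.
pair-tri : ∀ n m → pair n m ≡ tri (n + m) + m
pair-tri n m = cong (_+ m) (begin
    ⌊ (n + m) * suc (n + m) /2⌋  ≡⟨ cong ⌊_/2⌋ (tri-double (n + m)) ⟩
    ⌊ tri (n + m) * 2 /2⌋        ≡⟨ ⌊n*2/2⌋≡n (tri (n + m)) ⟩
    tri (n + m)                  ∎)
  where open ≡-Reasoning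

tri-mono : ∀ {s s'} → s ≤ s' → tri s ≤ tri s'
tri-mono z≤n     = z≤n
tri-mono (s≤s p) = +-mono-≤ (s≤s p) (tri-mono p)

diagonal-< : ∀ {s s'} m m' → m ≤ s → s < s' → tri s + m < tri s' + m'
diagonal-< {s} {s'} m m' m≤s s<s' = begin-strict
    tri s + m      ≤⟨ +-monoʳ-≤ (tri s) m≤s ⟩
    tri s + s      <⟨ +-monoʳ-< (tri s) (n<1+n s) ⟩
    tri s + suc s  ≡⟨ +-comm (tri s) (suc s) ⟩
    tri (suc s)    ≤⟨ tri-mono s<s' ⟩
    tri s'         ≤⟨ m≤m+n (tri s') m' ⟩
    tri s' + m'    ∎
  where open ≤-Reasoning

same-diagonal : ∀ {s s'} m m' → m ≤ s → m' ≤ s' → tri s + m ≡ tri s' + m' → s ≡ s'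
same-diagonal {s} {s'} m m' m≤s m'≤s' eq with <-cmp s s'
... | tri< s<s' _ _ = ⊥-elim (<-irrefl eq (diagonal-< m m' m≤s s<s'))
... | tri≈ _ s≡s' _ = s≡s'
... | tri> _ _ s>s' = ⊥-elim (<-irrefl (sym eq) (diagonal-< m' m m'≤s' s>s'))

pair-injective : ∀ n m n' m' → pair n m ≡ pair n' m' → n ≡ n' × m ≡ m'
pair-injective n m n' m' eq = n≡n' , m≡m'
  where
  eq' : tri (n + m) + m ≡ tri (n' + m') + m'
  eq' = trans (sym (pair-tri n m)) (trans eq (pair-tri n' m'))
  diag : n + m ≡ n' + m'
  diag = same-diagonal m m' (m≤n+m m n) (m≤n+m m' n') eq'
  m≡m' : m ≡ m'
  m≡m' = +-cancelˡ-≡ (tri (n + m)) m m' (trans eq' (cong (λ s → tri s + m') (sym diag)))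
  n≡n' : n ≡ n'
  n≡n' = +-cancelʳ-≡ m n n' (trans diag (cong (n' +_) (sym m≡m')))

Empty : 𝒮 → Set
Empty U = ∀ n → U n → ⊥

bit-zero : ∀ k → bit 0 k ≡ false
bit-zero zero    = refl
bit-zero (suc k) = bit-zero k

e0-empty : Empty (e 0)
e0-empty k k∈e0 with trans (sym (bit-zero k)) k∈e0
... | ()

e0⊆ : ∀ W → e 0 ⊆ W
e0⊆ W k k∈e0 = ⊥-elim (e0-empty k k∈e0)

-- ⟨ j ⟩ = 2^j is the code of the singleton {j}.
⟨_⟩ : ℕ → ℕ
⟨ zero ⟩  = 1
⟨ suc j ⟩ = ⟨ j ⟩ * 2

bit-double : ∀ n k → bit (n * 2) (suc k) ≡ bit n k
bit-double n k = cong (λ z → bit z k) (⌊n*2/2⌋≡n n)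

singleton-∋ : ∀ j → e ⟨ j ⟩ j
singleton-∋ zero    = refl
singleton-∋ (suc j) = trans (bit-double ⟨ j ⟩ j) (singleton-∋ j)

singleton-only : ∀ j k → e ⟨ j ⟩ k → k ≡ j
singleton-only zero    zero    _ = refl
singleton-only zero    (suc k) k∈ with trans (sym (bit-zero k)) k∈
... | ()
singleton-only (suc j) zero    k∈ with trans (sym (cong (_≡ᵇ 1) (m*n%n≡0 ⟨ j ⟩ 2))) k∈
... | ()
singleton-only (suc j) (suc k) k∈ =
  cong suc (singleton-only j k (trans (sym (bit-double ⟨ j ⟩ k)) k∈))

singleton⊆ : ∀ {U j} → U j → e ⟨ j ⟩ ⊆ U
singleton⊆ {U} {j} Uj k k∈ = subst U (sym (singleton-only j k k∈)) Uj

≐-sym : ∀ {U V} → U ≐ V → V ≐ U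
≐-sym (U⊆V , V⊆U) = V⊆U , U⊆V

·-monoʳ : ∀ r {U V} → U ⊆ V → (r · U) ⊆ (r · V)
·-monoʳ r U⊆V m (n , en⊆U , rnm) = n , (λ k k∈ → U⊆V k (en⊆U k k∈)) , rnm

∅ : 𝒮
∅ _ = ⊥

｛1｝ : 𝒮
｛1｝ n = n ≡ 1

∅-realizes-0 : E-Sierpinski false ∅
∅-realizes-0 _ ()

｛1｝-realizes-1 : E-Sierpinski true ｛1｝
｛1｝-realizes-1 = refl , λ _ n≡1 → n≡1

K : 𝒮
K l = Σ ℕ λ n → Σ ℕ λ m → Σ ℕ λ j → (l ≡ pair n (pair m j)) × e n j

K-spec : ∀ U W → (K · U · W) ≐ U
K-spec U W = contained , contains
  where
  contains : U ⊆ (K · U · W)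
  contains j Uj = 0 , e0⊆ W , ⟨ j ⟩ , singleton⊆ Uj , ⟨ j ⟩ , 0 , j , refl , singleton-∋ j
  contained : (K · U · W) ⊆ U
  contained j (m , _ , n , en⊆U , n' , m' , j' , eq , j∈en) with pair-injective n (pair m j) n' (pair m' j') eq
  ... | refl , eq₂ with pair-injective m j m' j' eq₂
  ... | refl , refl = en⊆U j j∈en

atEmpty : 𝒮
atEmpty l = Σ ℕ λ n → Σ ℕ λ k → Σ ℕ λ m →
  (l ≡ pair n m) × Empty (e k) × e n (pair k m)

atEmpty-spec : ∀ V → (atEmpty · V) ≐ (V · ∅)
atEmpty-spec V = contained , contains
  where
  contains : (V · ∅) ⊆ (atEmpty · V)
  contains m (k , ek⊆∅ , Vkm) =
    ⟨ pair k m ⟩ , singleton⊆ Vkm , ⟨ pair k m ⟩ , k , m , refl , ek⊆∅ , singleton-∋ (pair k m)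
  contained : (atEmpty · V) ⊆ (V · ∅)
  contained m (n , en⊆V , n' , k , m' , eq , ek-empty , km∈en) with pair-injective n m n' m' eq
  ... | refl , refl = k , ek-empty , en⊆V _ km∈en

branch : 𝒮 → 𝒮 → 𝒮
branch U V l = Σ ℕ λ n → Σ ℕ λ m →
  (l ≡ pair n m) × ((Empty (e n) × U m) ⊎ (e n 1 × V m))

branch-∅ : ∀ U V W → Empty W → (branch U V · W) ≐ U
branch-∅ U V W W-empty = contained , contains
  where
  contains : U ⊆ (branch U V · W)
  contains m Um = 0 , e0⊆ W , 0 , m , refl , inj₁ (e0-empty , Um)
  contained : (branch U V · W) ⊆ U
  contained m (n , en⊆W , n' , m' , eq , choice) with pair-injective n m n' m' eq | choice
  ... | refl , refl | inj₁ (_ , Um)   = Um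
  ... | refl , refl | inj₂ (1∈en , _) = ⊥-elim (W-empty 1 (en⊆W 1 1∈en))

branch-1 : ∀ U V W → W 1 → U ⊆ V → (branch U V · W) ≐ V
branch-1 U V W W1 U⊆V = contained , contains
  where
  contains : V ⊆ (branch U V · W)
  contains m Vm = ⟨ 1 ⟩ , singleton⊆ W1 , ⟨ 1 ⟩ , m , refl , inj₂ (singleton-∋ 1 , Vm)
  contained : (branch U V · W) ⊆ V
  contained m (n , en⊆W , n' , m' , eq , choice) with pair-injective n m n' m' eq | choice
  ... | refl , refl | inj₁ (_ , Um) = U⊆V m Um
  ... | refl , refl | inj₂ (_ , Vm) = Vm

RealizersDiscrete : Assembly → Set₁
RealizersDiscrete X =
  ∀ x y → (Σ 𝒮 λ U → Σ 𝒮 λ V → E X x U × E X y V × U ⊆ V) → x ≡ y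

module _ (X : Assembly) where

  twoPoint : Carrier X → Carrier X → Bool → Carrier X
  twoPoint x _ false = x
  twoPoint _ y true  = y

  twoPoint-tracked : ∀ {x y U V} → E X x U → E X y V → U ⊆ V →
    TrackedΣ X (twoPoint x y) (branch U V)
  twoPoint-tracked {x} {U = U} {V} Ux _  _   false W W-empty =
    E-ext X x U (branch U V · W) (≐-sym (branch-∅ U V W W-empty)) Ux
  twoPoint-tracked {y = y} {U} {V} _  Vy U⊆V true W (W1 , _) =
    E-ext X y V (branch U V · W) (≐-sym (branch-1 U V W W1 U⊆V)) Vy

  orderDiscrete⇒realizersDiscrete : IsOrderDiscrete X → RealizersDiscrete X
  orderDiscrete⇒realizersDiscrete (_ , g , _ , _ , _ , δ∘g≡id) x y (U , V , Ux , Vy , U⊆V) =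
    trans (sym (δ∘g≡id f tracked false)) (δ∘g≡id f tracked true)
    where
    f : Bool → Carrier X
    f = twoPoint x y
    tracked : IsTrackedΣ X f
    tracked = branch U V , twoPoint-tracked Ux Vy U⊆V

  -- Under discrete realizers every tracked map Σ → X is constant,
  -- since its realizers r · ∅ ⊆ r · {1} are comparable.
  tracked-constant : RealizersDiscrete X → ∀ f → IsTrackedΣ X f → f false ≡ f true
  tracked-constant discrete f (r , tracks) =
    discrete (f false) (f true)
      ( r · ∅ , r · ｛1｝
      , tracks false ∅ ∅-realizes-0 , tracks true ｛1｝ ｛1｝-realizes-1
      , ·-monoʳ r (λ _ ()) )

  realizersDiscrete⇒orderDiscrete : RealizersDiscrete X → IsOrderDiscrete X
  realizersDiscrete⇒orderDiscrete discrete =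
    (K , δ-tracked) , evalAt0 , (λ _ _ _ → refl) , (atEmpty , evalAt0-tracked) ,
    (λ _ _ → refl) , δ∘evalAt0≡id
    where
    δ-tracked : ∀ x U → E X x U → TrackedΣ X (δ X x) (K · U)
    δ-tracked x U Ux _ W _ = E-ext X x U (K · U · W) (≐-sym (K-spec U W)) Ux
    evalAt0 : (f : Bool → Carrier X) → IsTrackedΣ X f → Carrier X
    evalAt0 f _ = f false
    evalAt0-tracked : ∀ f p V → TrackedΣ X f V → E X (evalAt0 f p) (atEmpty · V)
    evalAt0-tracked f _ V tracks =
      E-ext X (f false) (V · ∅) (atEmpty · V) (≐-sym (atEmpty-spec V)) (tracks false ∅ ∅-realizes-0)
    δ∘evalAt0≡id : ∀ f p b → δ X (evalAt0 f p) b ≡ f b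
    δ∘evalAt0≡id _ _ false = refl
    δ∘evalAt0≡id f p true  = tracked-constant discrete f p

corollary3p7 : (X : Assembly) →
    IsOrderDiscrete X ⇔
      (∀ x y → (Σ 𝒮 λ U → Σ 𝒮 λ V → E X x U × E X y V × U ⊆ V) → x ≡ y)
corollary3p7 X =
  mk⇔ (orderDiscrete⇒realizersDiscrete X) (realizersDiscrete⇒orderDiscrete X)
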